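{- Let $1\leqslant k\leqslant d$ and let $F\subseteq S^d$ be a $k$-neighborly family of maximum possible size (among all $k$-neighborly families in $S^d$). Then every string in $F$ has at most $d-k$ jokers.
   Context: Let $S=\{0,1,\ast\}$ and let $S^d$ be the set of strings of length $d$ over $S$; the symbol $\ast$ is called a joker. For $x,y\in S^d$, $d(x,y)$ is the number of positions $i$ such that one of $x_i,y_i$ is $0$ and the other is $1$. A family $F\subseteq S^d$ is $k$-neighborly if $1\leqslant d(x,y)\leqslant k$ for every two distinct $x,y\in F$. -}

module Defs where

open import Data.Nat using (ℕ; zero; suc; _+_; _≤_)
open import Data.Vec using (Vec; []; _∷_)
open import Data.List using (List; length)
open import Data.List.Membership.Propositional using (_∈_)
open import Data.List.Relation.Unary.Unique.Propositional using (Unique)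
open import Relation.Binary.PropositionalEquality using (_≡_)
open import Relation.Nullary using (¬_)

data Sym : Set where
  s0 s1 joker : Sym

diff : Sym → Sym → ℕ
diff s0 s1 = 1
diff s1 s0 = 1
diff _ _ = 0

dist : ∀ {d} → Vec Sym d → Vec Sym d → ℕ
dist [] [] = 0
dist (a ∷ x) (b ∷ y) = diff a b + dist x y

jokers : ∀ {d} → Vec Sym d → ℕ
jokers [] = 0
jokers (joker ∷ x) = suc (jokers x)
jokers (s0 ∷ x) = jokers x
jokers (s1 ∷ x) = jokers x

-- A family F ⊆ S^d, represented as a duplicate-free list.
-- k-neighborly: 1 ≤ d(x,y) ≤ k for every two distinct x, y ∈ F
Neighborly : ∀ {d} → ℕ → List (Vec Sym d) → Set
Neighborly k F = ∀ {x y} → x ∈ F → y ∈ F → ¬ (x ≡ y) → 1 ≤ dist x y × dist x y ≤ k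
  where open import Data.Product using (_×_)

MaxNeighborly : ∀ d → ℕ → List (Vec Sym d) → Set
MaxNeighborly d k F =
  Unique F × Neighborly k F ×
  (∀ (G : List (Vec Sym d)) → Unique G → Neighborly k G → length G ≤ length F)
  where open import Data.Product using (_×_)

-- If x has more than d − k jokers, then d(x, y) ≤ d − jokers(x) < k for every y.  Filling one
-- joker of x with 0 and with 1 gives two strings at distance 1 from each other whose distance
-- to any other string of F is at least d(x, y) ≥ 1 and at most d(x, y) + 1 ≤ k, so replacing x
-- by them yields a larger k-neighborly family.
module Submission where

open import Defs
open import Data.Nat using (ℕ; _≤_; _∸_)
open import Data.Vec using (Vec)
open import Data.List using (List)
open import Data.List.Membership.Propositional using (_∈_)

open import Data.Nat using (suc; _+_; _<_; _≤?_; z≤n; s≤s)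
open import Data.Nat.Properties
open import Data.Vec using ([]; _∷_)
open import Data.List using ([]; _∷_; _++_; length)
open import Data.List.Membership.Propositional.Properties using (∈-∃++)
open import Data.List.Relation.Unary.Any using (here; there)
open import Data.List.Relation.Unary.All as All using (_∷_)
open import Data.List.Relation.Unary.AllPairs as AllPairs using (AllPairs; _∷_)
open import Data.List.Relation.Unary.Unique.Propositional using (Unique)
open import Data.List.Relation.Binary.Permutation.Propositional using (_↭_; ↭⇒↭ₛ)
open import Data.List.Relation.Binary.Permutation.Propositional.Properties using (shift; ↭-length)
import Data.List.Relation.Binary.Permutation.Setoid.Properties as Permutationₛ
open import Data.Product using (_×_; _,_; ∃; <_,_>; uncurry)
open import Relation.Binary using (Rel; Symmetric)
open import Relation.Nullary using (¬_; yes; no; contradiction)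
open import Relation.Binary.PropositionalEquality

module _ {A : Set} {ℓ} {R : Rel A ℓ} (R-sym : Symmetric R) where

  allPairs-lookup : ∀ {xs x y} → AllPairs R xs → x ∈ xs → y ∈ xs → ¬ x ≡ y → R x y
  allPairs-lookup (_  ∷ _)  (here refl) (here refl) x≢y = contradiction refl x≢y
  allPairs-lookup (Rx ∷ _)  (here refl) (there y∈)  _   = All.lookup Rx y∈
  allPairs-lookup (Ry ∷ _)  (there x∈)  (here refl) _   = R-sym (All.lookup Ry x∈)
  allPairs-lookup (_  ∷ Rs) (there x∈)  (there y∈)  x≢y = allPairs-lookup Rs x∈ y∈ x≢y

  allPairs-resp-↭ : ∀ {xs ys} → xs ↭ ys → AllPairs R xs → AllPairs R ys
  allPairs-resp-↭ p = Permutationₛ.AllPairs-resp-↭ (setoid A) R-sym (resp₂ R) (↭⇒↭ₛ p)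

∈⇒↭∷ : ∀ {A : Set} {x : A} {xs} → x ∈ xs → ∃ λ ys → xs ↭ x ∷ ys
∈⇒↭∷ {x = x} x∈ with ys , zs , refl ← ∈-∃++ x∈ = ys ++ zs , shift x ys zs

diff-sym : ∀ a b → diff a b ≡ diff b a
diff-sym s0    s0    = refl
diff-sym s0    s1    = refl
diff-sym s0    joker = refl
diff-sym s1    s0    = refl
diff-sym s1    s1    = refl
diff-sym s1    joker = refl
diff-sym joker s0    = refl
diff-sym joker s1    = refl
diff-sym joker joker = refl

diff-self : ∀ a → diff a a ≡ 0
diff-self s0    = refl
diff-self s1    = refl
diff-self joker = refl

diff≤1 : ∀ a b → diff a b ≤ 1
diff≤1 s0    s0    = z≤n
diff≤1 s0    s1    = ≤-refl
diff≤1 s0    joker = z≤n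
diff≤1 s1    s0    = ≤-refl
diff≤1 s1    s1    = z≤n
diff≤1 s1    joker = z≤n
diff≤1 joker _     = z≤n

dist-sym : ∀ {d} (x y : Vec Sym d) → dist x y ≡ dist y x
dist-sym []      []      = refl
dist-sym (a ∷ x) (b ∷ y) = cong₂ _+_ (diff-sym a b) (dist-sym x y)

dist-self : ∀ {d} (x : Vec Sym d) → dist x x ≡ 0
dist-self []      = refl
dist-self (a ∷ x) = cong₂ _+_ (diff-self a) (dist-self x)

dist+jokers≤d : ∀ {d} (x y : Vec Sym d) → dist x y + jokers x ≤ d
dist+jokers≤d []          []      = z≤n
dist+jokers≤d (joker ∷ x) (b ∷ y) rewrite +-suc (dist x y) (jokers x) = s≤s (dist+jokers≤d x y)
dist+jokers≤d (s0 ∷ x)    (b ∷ y) rewrite +-assoc (diff s0 b) (dist x y) (jokers x) =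
  +-mono-≤ (diff≤1 s0 b) (dist+jokers≤d x y)
dist+jokers≤d (s1 ∷ x)    (b ∷ y) rewrite +-assoc (diff s1 b) (dist x y) (jokers x) =
  +-mono-≤ (diff≤1 s1 b) (dist+jokers≤d x y)

dist<k : ∀ {k d} (x y : Vec Sym d) → k ≤ d → d ∸ k < jokers x → dist x y < k
dist<k {k} {d} x y k≤d d∸k<jokers = +-cancelʳ-< (d ∸ k) (dist x y) k (begin-strict
  dist x y + (d ∸ k)    <⟨ +-monoʳ-< (dist x y) d∸k<jokers ⟩
  dist x y + jokers x   ≤⟨ dist+jokers≤d x y ⟩
  d                     ≡⟨ m+[n∸m]≡n k≤d ⟨
  k + (d ∸ k)           ∎)
  where open ≤-Reasoning

fillJoker : ∀ {d} → Sym → Vec Sym d → Vec Sym d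
fillJoker s []          = []
fillJoker s (joker ∷ x) = s ∷ x
fillJoker s (s0 ∷ x)    = s0 ∷ fillJoker s x
fillJoker s (s1 ∷ x)    = s1 ∷ fillJoker s x

dist≤dist-fillJoker : ∀ {d} s (x y : Vec Sym d) → dist x y ≤ dist (fillJoker s x) y
dist≤dist-fillJoker s []          []      = z≤n
dist≤dist-fillJoker s (joker ∷ x) (b ∷ y) = m≤n+m (dist x y) (diff s b)
dist≤dist-fillJoker s (s0 ∷ x)    (b ∷ y) = +-monoʳ-≤ (diff s0 b) (dist≤dist-fillJoker s x y)
dist≤dist-fillJoker s (s1 ∷ x)    (b ∷ y) = +-monoʳ-≤ (diff s1 b) (dist≤dist-fillJoker s x y)

dist-fillJoker≤suc-dist : ∀ {d} s (x y : Vec Sym d) → dist (fillJoker s x) y ≤ suc (dist x y)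
dist-fillJoker≤suc-dist s []          []      = z≤n
dist-fillJoker≤suc-dist s (joker ∷ x) (b ∷ y) = +-monoˡ-≤ (dist x y) (diff≤1 s b)
dist-fillJoker≤suc-dist s (s0 ∷ x)    (b ∷ y) rewrite sym (+-suc (diff s0 b) (dist x y)) =
  +-monoʳ-≤ (diff s0 b) (dist-fillJoker≤suc-dist s x y)
dist-fillJoker≤suc-dist s (s1 ∷ x)    (b ∷ y) rewrite sym (+-suc (diff s1 b) (dist x y)) =
  +-monoʳ-≤ (diff s1 b) (dist-fillJoker≤suc-dist s x y)

dist-fillJoker-s0-s1 : ∀ {d} (x : Vec Sym d) → 1 ≤ jokers x →
                       dist (fillJoker s0 x) (fillJoker s1 x) ≡ 1
dist-fillJoker-s0-s1 (joker ∷ x) _ = cong suc (dist-self x)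
dist-fillJoker-s0-s1 (s0 ∷ x)    j = dist-fillJoker-s0-s1 x j
dist-fillJoker-s0-s1 (s1 ∷ x)    j = dist-fillJoker-s0-s1 x j

module _ {d k : ℕ} where

  record Near (x y : Vec Sym d) : Set where
    constructor near
    field
      1≤dist : 1 ≤ dist x y
      dist≤k : dist x y ≤ k

  near-sym : Symmetric Near
  near-sym {x} {y} (near 1≤dist dist≤k) rewrite dist-sym x y = near 1≤dist dist≤k

  near⇒≢ : ∀ {x y} → Near x y → ¬ x ≡ y
  near⇒≢ {x} (near 1≤dist _) refl = <⇒≢ 1≤dist (sym (dist-self x))

  near-fillJoker : ∀ s {x y} → dist x y < k → Near x y → Near (fillJoker s x) y
  near-fillJoker s {x} {y} close (near 1≤dist _) =
    near (≤-trans 1≤dist (dist≤dist-fillJoker s x y)) (≤-trans (dist-fillJoker≤suc-dist s x y) close)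

  neighborly⇒allPairs : ∀ {F : List (Vec Sym d)} → Unique F → Neighborly k F → AllPairs Near F
  neighborly⇒allPairs {[]}    _         _  = AllPairs.[]
  neighborly⇒allPairs {x ∷ F} (x∉ ∷ uF) nb =
    All.tabulate (λ y∈ → uncurry near (nb (here refl) (there y∈) (All.lookup x∉ y∈))) ∷
    neighborly⇒allPairs uF (λ y∈ z∈ → nb (there y∈) (there z∈))

  allPairs⇒unique : ∀ {F : List (Vec Sym d)} → AllPairs Near F → Unique F
  allPairs⇒unique = AllPairs.map near⇒≢

  allPairs⇒neighborly : ∀ {F : List (Vec Sym d)} → AllPairs Near F → Neighborly k F
  allPairs⇒neighborly nearF x∈ y∈ x≢y =
    < Near.1≤dist , Near.dist≤k > (allPairs-lookup near-sym nearF x∈ y∈ x≢y)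

  near-split : ∀ {x : Vec Sym d} {F} → 1 ≤ jokers x → (∀ y → dist x y < k) →
               AllPairs Near (x ∷ F) →
               AllPairs Near (fillJoker s0 x ∷ fillJoker s1 x ∷ F)
  near-split {x} 1≤jokers close (nearX ∷ nearF) =
    (near-s0-s1 ∷ All.map (λ {y} → near-fillJoker s0 (close y)) nearX) ∷
    All.map (λ {y} → near-fillJoker s1 (close y)) nearX ∷
    nearF
    where
    near-s0-s1 : Near (fillJoker s0 x) (fillJoker s1 x)
    near-s0-s1 = near (≤-reflexive (sym dist≡1)) (subst (_≤ k) (sym dist≡1) 1≤k)
      where
      dist≡1 : dist (fillJoker s0 x) (fillJoker s1 x) ≡ 1
      dist≡1 = dist-fillJoker-s0-s1 x 1≤jokers
      1≤k : 1 ≤ k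
      1≤k = subst (_< k) (dist-self x) (close x)

  many-jokers⇒larger-family : ∀ {F : List (Vec Sym d)} {x} → k ≤ d → d ∸ k < jokers x →
    Unique F → Neighborly k F → x ∈ F →
    ∃ λ G → Unique G × Neighborly k G × length F < length G
  many-jokers⇒larger-family {x = x} k≤d many uF nbF x∈F with rest , F↭x∷rest ← ∈⇒↭∷ x∈F =
    _ , allPairs⇒unique nearG , allPairs⇒neighborly nearG , ≤-reflexive (cong suc (↭-length F↭x∷rest))
    where
    nearG : AllPairs Near (fillJoker s0 x ∷ fillJoker s1 x ∷ rest)
    nearG = near-split (≤-trans (s≤s z≤n) many) (λ y → dist<k x y k≤d many)
              (allPairs-resp-↭ near-sym F↭x∷rest (neighborly⇒allPairs uF nbF))

lemma3p1 : ∀ (k d : ℕ) → 1 ≤ k → k ≤ d → (F : List (Vec Sym d)) →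
           MaxNeighborly d k F → ∀ x → x ∈ F → jokers x ≤ d ∸ k
lemma3p1 k d _ k≤d F (uF , nbF , maximal) x x∈F with jokers x ≤? d ∸ k
... | yes few  = few
... | no many with G , uG , nbG , F<G ← many-jokers⇒larger-family k≤d (≰⇒> many) uF nbF x∈F =
  contradiction (maximal G uG nbG) (<⇒≱ F<G)
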